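{- Let $k$ be a positive integer. Let $G=(V,E,\partial)$ be a finite undirected graph with $V$ the disjoint union of $\{v_1,v_2,v_3,v_4\}$ (four distinct vertices) and a (possibly empty) set $Y$, such that for every edge $e\in E$ at least one of the two vertices of $\partial(e)$ lies in $\{v_1,v_2,v_3,v_4\}$. Suppose that the degree of each of $v_1,v_2,v_3,v_4$ is at least $k$, that every vertex in $Y$ has even degree, and that for each $y\in Y$ and each $1\le i\le 4$, the number of edges $e$ with $\partial(e)=y+v_i$ is not greater than the total number of edges $a$ with $\partial(a)=y+w$ for some vertex $w\ne v_i$. Then there exist $k$ chains of edges $p_1,\ldots,p_k\in A(E)$, no two of which have a common nontrivial summand, such that $\partial(p_1)=\cdots=\partial(p_k)=v_1+v_2+v_3+v_4$.
   Context: A graph $G=(V,E,\partial)$ consists of a finite nonempty vertex set $V$, a finite edge set $E$, and a map $\partial$ assigning to each edge a set of exactly two distinct vertices (parallel edges allowed, no loops); we write $\partial(e)=a+b$ for $\partial(e)=\{a,b\}$. The degree of a vertex $v$ is the number of edges $e$ with $v\in\partial(e)$. $A(S)$ is the $\mathbb{F}_2$-vector space of formal $\mathbb{F}_2$-linear combinations of elements of $S$; elements of $A(E)$ are chains of edges, with summands the edges of coefficient $1$. Two chains have no common nontrivial summand if no edge is a summand of both. $\partial$ extends $\mathbb{F}_2$-linearly to $A(E)\to A(V)$. -}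

module Defs where

open import Data.Nat using (ℕ; zero; suc; _+_)
open import Data.Bool using (Bool; true; false; _∧_; _∨_; _xor_; not)
open import Data.Fin using (Fin; zero; suc; _≟_)
open import Relation.Nullary.Decidable using (⌊_⌋)
open import Relation.Binary.PropositionalEquality using (_≢_)

indicator : Bool → ℕ
indicator true = 1
indicator false = 0

count : ∀ {m} → (Fin m → Bool) → ℕ
count {zero} P = 0
count {suc m} P = indicator (P zero) + count {m} (λ i → P (suc i))

parity : ∀ {m} → (Fin m → Bool) → Bool
parity {zero} P = false
parity {suc m} P = P zero xor parity {m} (λ i → P (suc i))

record Graph (n m : ℕ) : Set where
  field
    end₁ end₂ : Fin m → Fin n
    loopless : ∀ e → end₁ e ≢ end₂ e
open Graph public

_==_ : ∀ {n} → Fin n → Fin n → Bool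
a == b = ⌊ a ≟ b ⌋

incident : ∀ {n m} → Graph n m → Fin m → Fin n → Bool
incident G e v = (end₁ G e == v) ∨ (end₂ G e == v)

degree : ∀ {n m} → Graph n m → Fin n → ℕ
degree G v = count (λ e → incident G e v)

joins : ∀ {n m} → Graph n m → Fin m → Fin n → Fin n → Bool
joins G e a b = ((end₁ G e == a) ∧ (end₂ G e == b)) ∨ ((end₁ G e == b) ∧ (end₂ G e == a))

multiplicity : ∀ {n m} → Graph n m → Fin n → Fin n → ℕ
multiplicity G a b = count (λ e → joins G e a b)

edgesAvoiding : ∀ {n m} → Graph n m → Fin n → Fin n → ℕ
edgesAvoiding G y v = count (λ e → incident G e y ∧ not (incident G e v))

-- chains of edges: elements of A(E), i.e. F₂-valued functions on E
Chain : ℕ → Set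
Chain m = Fin m → Bool

-- ∂ extended F₂-linearly: A(E) → A(V) (elements of A(V) as Fin n → Bool)
boundary : ∀ {n m} → Graph n m → Chain m → Fin n → Bool
boundary G p v = parity (λ e → p e ∧ incident G e v)

-- membership in {v₁,v₂,v₃,v₄} as a Boolean; also the chain v₁+v₂+v₃+v₄ ∈ A(V)
inFour : ∀ {n} → (Fin 4 → Fin n) → Fin n → Bool
inFour vs v = (vs zero == v) ∨ (vs (suc zero) == v) ∨ (vs (suc (suc zero)) == v) ∨ (vs (suc (suc (suc zero))) == v)

{-# OPTIONS --safe #-}
-- At each other vertex y, list its edges by the
-- index of that far end and pair the t-th with the (deg y / 2 + t)-th: since deg y is even
-- and no v_i receives more than half of the edges at y, the two far ends differ, so each
-- pair can be split off into one edge between two of the v_i.  This leaves a multigraph on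
-- four vertices of minimum degree ≥ k, from which k edge-disjoint sets with all four degrees
-- odd are peeled off one at a time: a perfect matching if one is present, otherwise a star,
-- and either keeps every degree ≥ k − 1.  Each set pulls back to a chain; it meets every y
-- in pairs of edges, hence evenly, and every v_i oddly.
module Submission where

open import Defs
open import Data.Nat using (ℕ; zero; suc; _+_; _∸_; _≤_; _<_; _<ᵇ_; _≡ᵇ_; ⌊_/2⌋; z≤n; s≤s)
import Data.Nat as ℕ
open import Data.Nat.Properties hiding (_≟_)
open import Data.Nat.Divisibility using (_∣_; divides)
open import Data.Bool using (Bool; true; false; _∧_; _∨_; not; _xor_; if_then_else_)
open import Data.Bool.Properties
  using (∧-identityʳ; ∧-zeroʳ; ∨-identityʳ; ∨-zeroʳ; ∧-comm; ∨-comm; xor-same; not-distribˡ-xor; T-≡)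
open import Data.Fin using (Fin; zero; suc; toℕ; _≟_)
import Data.Fin.Properties as Fin
open import Data.Product using (Σ; ∃; _×_; _,_; proj₁; proj₂)
open import Data.Sum using (_⊎_; inj₁)
open import Data.Empty using (⊥-elim)
open import Function using (_∘_; Equivalence)
open import Function.Definitions using (Injective)
open import Relation.Nullary using (yes; no; contradiction)
open import Relation.Nullary.Decidable using (isYes≗does; dec-true; dec-false; from-yes; ¬?; _→-dec_)
open import Relation.Binary.PropositionalEquality
open import Algebra.Properties.CommutativeSemigroup +-commutativeSemigroup using (interchange)
open import Algebra.Properties.CommutativeMonoid.Sum +-0-commutativeMonoid
  using (sum; ∑-distrib-+; sum-cong-≗; sum-replicate-zero)

Σ< : ℕ → (ℕ → ℕ) → ℕ
Σ< zero    f = 0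
Σ< (suc h) f = Σ< h f + f h

Σ<-cong : ∀ h {f g : ℕ → ℕ} → (∀ r → r < h → f r ≡ g r) → Σ< h f ≡ Σ< h g
Σ<-cong zero    f≡g = refl
Σ<-cong (suc h) f≡g = cong₂ _+_ (Σ<-cong h (λ r r<h → f≡g r (m<n⇒m<1+n r<h))) (f≡g h ≤-refl)

Σ<-+ : ∀ a b (f : ℕ → ℕ) → Σ< (a + b) f ≡ Σ< a f + Σ< b (λ r → f (a + r))
Σ<-+ a zero    f = trans (cong (λ h → Σ< h f) (+-identityʳ a)) (sym (+-identityʳ _))
Σ<-+ a (suc b) f = begin
  Σ< (a + suc b) f                          ≡⟨ cong (λ h → Σ< h f) (+-suc a b) ⟩
  Σ< (a + b) f + f (a + b)                  ≡⟨ cong (_+ f (a + b)) (Σ<-+ a b f) ⟩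
  Σ< a f + Σ< b (λ r → f (a + r)) + f (a + b) ≡⟨ +-assoc (Σ< a f) _ _ ⟩
  Σ< a f + Σ< (suc b) (λ r → f (a + r))     ∎
  where open ≡-Reasoning

Σ<-distrib-+ : ∀ h (f g : ℕ → ℕ) → Σ< h (λ r → f r + g r) ≡ Σ< h f + Σ< h g
Σ<-distrib-+ zero    f g = refl
Σ<-distrib-+ (suc h) f g =
  trans (cong (_+ (f h + g h)) (Σ<-distrib-+ h f g)) (interchange (Σ< h f) (Σ< h g) (f h) (g h))

Σ<-zero : ∀ h → Σ< h (λ _ → 0) ≡ 0
Σ<-zero zero    = refl
Σ<-zero (suc h) = trans (+-identityʳ _) (Σ<-zero h)

bool-cases : ∀ {p} {P : Set p} b → (b ≡ true → P) → (b ≡ false → P) → P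
bool-cases true  if-true _        = if-true refl
bool-cases false _       if-false = if-false refl

<ᵇ-true : ∀ {m n} → m < n → (m <ᵇ n) ≡ true
<ᵇ-true m<n = Equivalence.to T-≡ (<⇒<ᵇ m<n)

<ᵇ-false : ∀ m n → n ≤ m → (m <ᵇ n) ≡ false
<ᵇ-false m       zero    _         = refl
<ᵇ-false (suc m) (suc n) (s≤s n≤m) = <ᵇ-false m n n≤m

≡ᵇ-refl : ∀ n → (n ≡ᵇ n) ≡ true
≡ᵇ-refl n = Equivalence.to T-≡ (≡⇒≡ᵇ n n refl)

≡ᵇ-false : ∀ m n → m ≢ n → (m ≡ᵇ n) ≡ false
≡ᵇ-false zero    zero    m≢n = ⊥-elim (m≢n refl)
≡ᵇ-false zero    (suc n) _   = refl
≡ᵇ-false (suc m) zero    _   = refl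
≡ᵇ-false (suc m) (suc n) m≢n = ≡ᵇ-false m n (m≢n ∘ cong suc)

≡ᵇ-true : ∀ m n → (m ≡ᵇ n) ≡ true → m ≡ n
≡ᵇ-true m n eq = ≡ᵇ⇒≡ m n (Equivalence.from T-≡ eq)

module _ {n : ℕ} where

  ==-refl : (a : Fin n) → (a == a) ≡ true
  ==-refl a = trans (isYes≗does (a ≟ a)) (dec-true (a ≟ a) refl)

  ==-false : {a b : Fin n} → a ≢ b → (a == b) ≡ false
  ==-false {a} {b} a≢b = trans (isYes≗does (a ≟ b)) (dec-false (a ≟ b) a≢b)

  ==-true : (a b : Fin n) → (a == b) ≡ true → a ≡ b
  ==-true a b eq with a ≟ b
  ... | yes a≡b = a≡b

  ==-sym : (a b : Fin n) → (a == b) ≡ (b == a)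
  ==-sym a b with a ≟ b
  ... | yes refl = sym (==-refl a)
  ... | no a≢b   = sym (==-false (a≢b ∘ sym))

  ==-∧-subst : ∀ (f : Fin n → Bool) a b → ((a == b) ∧ f a) ≡ ((a == b) ∧ f b)
  ==-∧-subst f a b with a ≟ b
  ... | yes refl = refl
  ... | no _     = refl

==-∧-subst₂ : ∀ {n k} (f : Fin n → Fin k → Bool) o x c c′ →
  (((o == x) ∧ f o c) ∧ (c == c′)) ≡ (((o == x) ∧ (c == c′)) ∧ f x c′)
==-∧-subst₂ f o x c c′ with o ≟ x | c ≟ c′
... | yes refl | yes refl = ∧-identityʳ _
... | yes refl | no _     = ∧-zeroʳ _
... | no _     | _        = refl

==-cong : ∀ {k n} {f : Fin k → Fin n} → (∀ {a b} → f a ≡ f b → a ≡ b) → ∀ a b → (f a == f b) ≡ (a == b)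
==-cong {f = f} f-inj a b with a ≟ b
... | yes refl = ==-refl (f a)
... | no a≢b   = ==-false (a≢b ∘ f-inj)


count-cong : ∀ {m} {P Q : Fin m → Bool} → (∀ e → P e ≡ Q e) → count P ≡ count Q
count-cong {zero}  P≡Q = refl
count-cong {suc m} P≡Q = cong₂ _+_ (cong indicator (P≡Q zero)) (count-cong (P≡Q ∘ suc))

count-false : ∀ {m} (P : Fin m → Bool) → (∀ e → P e ≡ false) → count P ≡ 0
count-false {zero}  P P≡false = refl
count-false {suc m} P P≡false rewrite P≡false zero = count-false (P ∘ suc) (P≡false ∘ suc)

count-∧-not : ∀ {m} (P Q : Fin m → Bool) →
  count P ≡ count (λ e → P e ∧ Q e) + count (λ e → P e ∧ not (Q e))
count-∧-not {zero}  P Q = refl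
count-∧-not {suc m} P Q rewrite count-∧-not (P ∘ suc) (Q ∘ suc) with P zero | Q zero
... | true  | true  = refl
... | true  | false = sym (+-suc _ _)
... | false | _     = refl

sum-indicator-== : ∀ {k} (c : Fin k) → sum (λ a → indicator (c == a)) ≡ 1
sum-indicator-== {suc k} zero    = cong suc (sum-replicate-zero k)
sum-indicator-== {suc k} (suc c) =
  trans (sum-cong-≗ (λ a → cong indicator (==-cong Fin.suc-injective c a))) (sum-indicator-== c)

count-partition : ∀ {m k} (P : Fin m → Bool) (f : Fin m → Fin k) →
  count P ≡ sum (λ a → count (λ e → P e ∧ (f e == a)))
count-partition {zero}  {k} P f = sym (sum-replicate-zero k)
count-partition {suc m} {k} P f = begin
  indicator (P zero) + count (P ∘ suc)
    ≡⟨ cong₂ _+_ (sym (sum-indicator-∧ (P zero))) (count-partition (P ∘ suc) (f ∘ suc)) ⟩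
  sum (λ a → indicator (P zero ∧ (f zero == a))) + sum (λ a → count (λ e → P (suc e) ∧ (f (suc e) == a)))
    ≡⟨ ∑-distrib-+ (λ a → indicator (P zero ∧ (f zero == a))) (λ a → count (λ e → P (suc e) ∧ (f (suc e) == a))) ⟨
  sum (λ a → count (λ e → P e ∧ (f e == a)))   ∎
  where
  open ≡-Reasoning
  sum-indicator-∧ : ∀ b → sum (λ a → indicator (b ∧ (f zero == a))) ≡ indicator b
  sum-indicator-∧ true  = sum-indicator-== (f zero)
  sum-indicator-∧ false = sum-replicate-zero k


odd : ℕ → Bool
odd zero    = false
odd (suc n) = not (odd n)

odd-+ : ∀ a b → odd (a + b) ≡ odd a xor odd b
odd-+ zero    b = refl
odd-+ (suc a) b rewrite odd-+ a b = not-distribˡ-xor (odd a) (odd b)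

odd-double : ∀ a → odd (a + a) ≡ false
odd-double a = trans (odd-+ a a) (xor-same (odd a))

parity≡odd-count : ∀ {m} (P : Fin m → Bool) → parity P ≡ odd (count P)
parity≡odd-count {zero}  P = refl
parity≡odd-count {suc m} P
  rewrite parity≡odd-count (P ∘ suc) | odd-+ (indicator (P zero)) (count (P ∘ suc)) with P zero
... | true  = refl
... | false = refl

rank : ∀ {m} → (Fin m → Bool) → Fin m → ℕ
rank P zero    = 0
rank P (suc e) = indicator (P zero) + rank (P ∘ suc) e

count-∧-rank : ∀ {m} (P : Fin m → Bool) (Q : ℕ → Bool) →
  count (λ e → P e ∧ Q (rank P e)) ≡ Σ< (count P) (indicator ∘ Q)
count-∧-rank {zero}  P Q = refl
count-∧-rank {suc m} P Q with P zero
... | true  = trans (cong (indicator (Q 0) +_) (count-∧-rank (P ∘ suc) (Q ∘ suc)))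
                    (sym (Σ<-+ 1 (count (P ∘ suc)) (indicator ∘ Q)))
... | false = count-∧-rank (P ∘ suc) Q

Σ<-∧-rank : ∀ h (A Q : ℕ → Bool) →
  Σ< h (λ t → indicator (A t ∧ Q (Σ< t (indicator ∘ A)))) ≡ Σ< (Σ< h (indicator ∘ A)) (indicator ∘ Q)
Σ<-∧-rank zero    A Q = refl
Σ<-∧-rank (suc h) A Q rewrite Σ<-∧-rank h A Q with A h
... | true  = cong (λ c → Σ< c (indicator ∘ Q)) (+-comm 1 (Σ< h (indicator ∘ A)))
... | false = trans (+-identityʳ _) (cong (λ c → Σ< c (indicator ∘ Q)) (sym (+-identityʳ (Σ< h (indicator ∘ A)))))

blockStart : ∀ {k} → (Fin k → ℕ) → Fin k → ℕ
blockStart P zero    = 0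
blockStart P (suc a) = P zero + blockStart (P ∘ suc) a

blockAt : ∀ {k} → (Fin (suc k) → ℕ) → ℕ → Fin (suc k)
blockAt {zero}  P ρ = zero
blockAt {suc k} P ρ = if ρ <ᵇ P zero then zero else suc (blockAt (P ∘ suc) (ρ ∸ P zero))

blockAt-start : ∀ {k} (P : Fin (suc k) → ℕ) a r → r < P a → blockAt P (blockStart P a + r) ≡ a
blockAt-start {zero}  P zero    r _   = refl
blockAt-start {suc k} P zero    r r<P rewrite <ᵇ-true r<P = refl
blockAt-start {suc k} P (suc a) r r<P
  rewrite +-assoc (P zero) (blockStart (P ∘ suc) a) r
        | <ᵇ-false (P zero + (blockStart (P ∘ suc) a + r)) (P zero) (m≤m+n _ _)
        | m+n∸m≡n (P zero) (blockStart (P ∘ suc) a + r)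
  = cong suc (blockAt-start (P ∘ suc) a r r<P)

blockAt-offset : ∀ {k} (P : Fin (suc k) → ℕ) ρ → ρ < sum P →
  ∃ λ r → r < P (blockAt P ρ) × ρ ≡ blockStart P (blockAt P ρ) + r
blockAt-offset {zero}  P ρ ρ<ΣP = ρ , subst (ρ <_) (+-identityʳ (P zero)) ρ<ΣP , refl
blockAt-offset {suc k} P ρ ρ<ΣP with ρ <? P zero
... | yes ρ<P₀ rewrite <ᵇ-true ρ<P₀ = ρ , ρ<P₀ , refl
... | no ρ≮P₀ rewrite <ᵇ-false ρ (P zero) (≮⇒≥ ρ≮P₀)
  with blockAt-offset (P ∘ suc) (ρ ∸ P zero)
         (+-cancelˡ-< (P zero) _ _ (subst (_< sum P) (sym (m+[n∸m]≡n (≮⇒≥ ρ≮P₀))) ρ<ΣP))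
... | r , r<P , ρ∸P₀≡ = r , r<P , (begin
  ρ                                   ≡⟨ m+[n∸m]≡n (≮⇒≥ ρ≮P₀) ⟨
  P zero + (ρ ∸ P zero)               ≡⟨ cong (P zero +_) ρ∸P₀≡ ⟩
  P zero + (blockStart (P ∘ suc) c + r) ≡⟨ +-assoc (P zero) _ r ⟨
  P zero + blockStart (P ∘ suc) c + r ∎)
  where
  open ≡-Reasoning
  c : Fin (suc k)
  c = blockAt (P ∘ suc) (ρ ∸ P zero)

sum-Σ<-blocks : ∀ {k} (P : Fin k → ℕ) (Q : ℕ → ℕ) →
  sum (λ a → Σ< (P a) (λ r → Q (blockStart P a + r))) ≡ Σ< (sum P) Q
sum-Σ<-blocks {zero}  P Q = refl
sum-Σ<-blocks {suc k} P Q = begin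
  Σ< (P zero) Q + sum (λ a → Σ< (P (suc a)) (λ r → Q (P zero + blockStart (P ∘ suc) a + r)))
    ≡⟨ cong (Σ< (P zero) Q +_) (sum-cong-≗ (λ a → Σ<-cong (P (suc a)) (λ r _ → cong Q (+-assoc (P zero) _ r)))) ⟩
  Σ< (P zero) Q + sum (λ a → Σ< (P (suc a)) (λ r → Q (P zero + (blockStart (P ∘ suc) a + r))))
    ≡⟨ cong (Σ< (P zero) Q +_) (sum-Σ<-blocks (P ∘ suc) (λ r → Q (P zero + r))) ⟩
  Σ< (P zero) Q + Σ< (sum (P ∘ suc)) (λ r → Q (P zero + r))
    ≡⟨ Σ<-+ (P zero) (sum (P ∘ suc)) Q ⟨
  Σ< (sum P) Q ∎
  where open ≡-Reasoning

blockAt-≢-empty : ∀ {k} (P : Fin (suc k) → ℕ) {a ρ} → P a ≡ 0 → ρ < sum P → blockAt P ρ ≢ a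
blockAt-≢-empty P Pa≡0 ρ<ΣP refl with blockAt-offset P _ ρ<ΣP
... | r , r<P , _ = n≮0 (subst (r <_) Pa≡0 r<P)

blockAt-≢-shift : ∀ {k} (P : Fin (suc k) → ℕ) {H} → (∀ a → P a ≤ H) →
  ∀ ρ → H + ρ < sum P → blockAt P ρ ≢ blockAt P (H + ρ)
blockAt-≢-shift {k} P {H} P≤H ρ H+ρ<ΣP same
  with blockAt-offset P ρ (<-≤-trans (s≤s (m≤n+m ρ H)) H+ρ<ΣP) | blockAt-offset P (H + ρ) H+ρ<ΣP
... | r₁ , _ , ρ≡ | r₂ , r₂<P , H+ρ≡ = <-irrefl refl (begin-strict
  H + ρ                       ≡⟨ H+ρ≡ ⟩
  blockStart P c₂ + r₂        <⟨ +-monoʳ-< (blockStart P c₂) (<-≤-trans r₂<P (P≤H c₂)) ⟩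
  blockStart P c₂ + H         ≡⟨ cong (λ c → blockStart P c + H) same ⟨
  blockStart P c₁ + H         ≤⟨ +-monoˡ-≤ H (m≤m+n _ r₁) ⟩
  blockStart P c₁ + r₁ + H    ≡⟨ cong (_+ H) ρ≡ ⟨
  ρ + H                       ≡⟨ +-comm ρ H ⟩
  H + ρ                       ∎)
  where
  open ≤-Reasoning
  c₁ c₂ : Fin (suc k)
  c₁ = blockAt P ρ
  c₂ = blockAt P (H + ρ)

pattern p0 = zero
pattern p1 = suc zero
pattern p2 = suc (suc zero)
pattern p3 = suc (suc (suc zero))
pattern p4 = suc (suc (suc (suc zero)))
pattern p5 = suc (suc (suc (suc (suc zero))))

-- The six edge types of a multigraph on Fin 4, i.e. its two-element subsets:
-- p0 = {0,1}, p1 = {2,3}, p2 = {0,2}, p3 = {1,3}, p4 = {0,3}, p5 = {1,2},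
-- so that p0 p1, p2 p3 and p4 p5 are its three perfect matchings (pair a a is junk).
Pair : Set
Pair = Fin 6

pair : Fin 4 → Fin 4 → Pair
pair p0 p1 = p0
pair p0 p2 = p2
pair p0 p3 = p4
pair p1 p0 = p0
pair p1 p2 = p5
pair p1 p3 = p3
pair p2 p0 = p2
pair p2 p1 = p5
pair p2 p3 = p1
pair p3 p0 = p4
pair p3 p1 = p3
pair p3 p2 = p1
pair _  _  = p0

pairDegree : (Pair → ℕ) → Fin 4 → ℕ
pairDegree N p0 = N p0 + N p2 + N p4
pairDegree N p1 = N p0 + N p3 + N p5
pairDegree N p2 = N p1 + N p2 + N p5
pairDegree N p3 = N p1 + N p3 + N p4

pairDegree-cong : ∀ {M N : Pair → ℕ} → (∀ τ → M τ ≡ N τ) → ∀ j → pairDegree M j ≡ pairDegree N j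
pairDegree-cong M≡N p0 rewrite M≡N p0 | M≡N p2 | M≡N p4 = refl
pairDegree-cong M≡N p1 rewrite M≡N p0 | M≡N p3 | M≡N p5 = refl
pairDegree-cong M≡N p2 rewrite M≡N p1 | M≡N p2 | M≡N p5 = refl
pairDegree-cong M≡N p3 rewrite M≡N p1 | M≡N p3 | M≡N p4 = refl

pairDegree-zero : ∀ j → pairDegree (λ _ → 0) j ≡ 0
pairDegree-zero p0 = refl
pairDegree-zero p1 = refl
pairDegree-zero p2 = refl
pairDegree-zero p3 = refl

+-interchange₃ : ∀ a b c d e f → (a + d) + (b + e) + (c + f) ≡ a + b + c + (d + e + f)
+-interchange₃ a b c d e f =
  sym (trans (interchange (a + b) c (d + e) f) (cong (_+ (c + f)) (interchange a b d e)))

pairDegree-+ : ∀ (M N : Pair → ℕ) j → pairDegree (λ τ → M τ + N τ) j ≡ pairDegree M j + pairDegree N j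
pairDegree-+ M N p0 = +-interchange₃ (M p0) (M p2) (M p4) (N p0) (N p2) (N p4)
pairDegree-+ M N p1 = +-interchange₃ (M p0) (M p3) (M p5) (N p0) (N p3) (N p5)
pairDegree-+ M N p2 = +-interchange₃ (M p1) (M p2) (M p5) (N p1) (N p2) (N p5)
pairDegree-+ M N p3 = +-interchange₃ (M p1) (M p3) (M p4) (N p1) (N p3) (N p4)

Σ<-pairDegree : ∀ h (g : ℕ → Pair → ℕ) j →
  Σ< h (λ t → pairDegree (g t) j) ≡ pairDegree (λ τ → Σ< h (λ t → g t τ)) j
Σ<-pairDegree zero    g j = sym (pairDegree-zero j)
Σ<-pairDegree (suc h) g j =
  trans (cong (_+ pairDegree (g h) j) (Σ<-pairDegree h g j)) (sym (pairDegree-+ _ (g h) j))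

sum-pairDegree : ∀ {n} (g : Fin n → Pair → ℕ) j →
  sum (λ x → pairDegree (g x) j) ≡ pairDegree (λ τ → sum (λ x → g x τ)) j
sum-pairDegree {zero}  g j = sym (pairDegree-zero j)
sum-pairDegree {suc n} g j =
  trans (cong (pairDegree (g zero) j +_) (sum-pairDegree (g ∘ suc) j)) (sym (pairDegree-+ (g zero) _ j))

pairDegree-pair : ∀ a b j → a ≢ b →
  pairDegree (λ τ → indicator (pair a b == τ)) j ≡ indicator ((a == j) ∨ (b == j))
pairDegree-pair = from-yes
  (Fin.all? λ a → Fin.all? λ b → Fin.all? λ j → ¬? (a ≟ b) →-dec
    (pairDegree (λ τ → indicator (pair a b == τ)) j ℕ.≟ indicator ((a == j) ∨ (b == j))))

pairDegree-pair-∧ : ∀ a b j (Z : Bool) → a ≢ b →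
  pairDegree (λ τ → indicator ((pair a b == τ) ∧ Z)) j ≡ indicator (((a == j) ∨ (b == j)) ∧ Z)
pairDegree-pair-∧ a b j true a≢b = begin
  pairDegree (λ τ → indicator ((pair a b == τ) ∧ true)) j ≡⟨ pairDegree-cong (λ τ → cong indicator (∧-identityʳ _)) j ⟩
  pairDegree (λ τ → indicator (pair a b == τ)) j          ≡⟨ pairDegree-pair a b j a≢b ⟩
  indicator ((a == j) ∨ (b == j))                         ≡⟨ cong indicator (∧-identityʳ _) ⟨
  indicator (((a == j) ∨ (b == j)) ∧ true)                ∎
  where open ≡-Reasoning
pairDegree-pair-∧ a b j false a≢b =
  trans (pairDegree-cong (λ τ → cong indicator (∧-zeroʳ (pair a b == τ))) j)
        (trans (pairDegree-zero j) (cong indicator (sym (∧-zeroʳ _))))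

indicator-==-∨ : ∀ {n} {a b : Fin n} j Z → a ≢ b →
  indicator ((a == j) ∧ Z) + indicator ((b == j) ∧ Z) ≡ indicator (((a == j) ∨ (b == j)) ∧ Z)
indicator-==-∨ {a = a} {b} j Z a≢b with a ≟ j | b ≟ j
... | yes refl | yes refl = ⊥-elim (a≢b refl)
... | yes _    | no _     = +-identityʳ _
... | no _     | _        = refl

record Peeling (k : ℕ) (N : Pair → ℕ) : Set where
  constructor peeling
  field
    chosen     : Pair → Bool
    chosen≤    : ∀ τ → indicator (chosen τ) ≤ N τ
    chosen-odd : ∀ j → odd (pairDegree (indicator ∘ chosen) j) ≡ true
    remaining  : ∀ j → k + pairDegree (indicator ∘ chosen) j ≤ pairDegree N j

multiplicities : ℕ → ℕ → ℕ → ℕ → ℕ → ℕ → Pair → ℕ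
multiplicities a b c d e f p0 = a
multiplicities a b c d e f p1 = b
multiplicities a b c d e f p2 = c
multiplicities a b c d e f p3 = d
multiplicities a b c d e f p4 = e
multiplicities a b c d e f p5 = f

selection : Bool → Bool → Bool → Bool → Bool → Bool → Pair → Bool
selection a b c d e f p0 = a
selection a b c d e f p1 = b
selection a b c d e f p2 = c
selection a b c d e f p3 = d
selection a b c d e f p4 = e
selection a b c d e f p5 = f

<⇒+1≤ : ∀ {k x} → k < x → k + 1 ≤ x
<⇒+1≤ {k} {x} = subst (_≤ x) (+-comm 1 k)

peel-matching : ∀ {k N} (P : Pair → Bool) → (∀ τ → indicator (P τ) ≤ N τ) →
  (∀ j → pairDegree (indicator ∘ P) j ≡ 1) → (∀ j → suc k ≤ pairDegree N j) → Peeling k N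
peel-matching {k} {N} P P≤N deg≡1 deg≥ = peeling P P≤N
  (λ j → cong odd (deg≡1 j))
  (λ j → subst (λ d → k + d ≤ pairDegree N j) (sym (deg≡1 j)) (<⇒+1≤ (deg≥ j)))

star-centre : ∀ k x y z → suc k ≤ x → suc k ≤ y → suc k ≤ z → k + 3 ≤ x + y + z
star-centre k x y z k<x k<y k<z = begin
  k + 3               ≡⟨ +-comm k 3 ⟩
  3 + k               ≡⟨ cong suc (trans (+-comm 2 k) (sym (+-assoc k 1 1))) ⟩
  suc k + 1 + 1       ≤⟨ +-mono-≤ (+-mono-≤ k<x (m<n⇒0<n k<y)) (m<n⇒0<n k<z) ⟩
  x + y + z           ∎
  where open ≤-Reasoning

peel₆ : ∀ k a b c d e f → (∀ j → suc k ≤ pairDegree (multiplicities a b c d e f) j) →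
  Peeling k (multiplicities a b c d e f)
peel₆ k (suc a) (suc b) c d e f deg≥ =
  peel-matching (selection true true false false false false)
    (λ { p0 → s≤s z≤n ; p1 → s≤s z≤n ; p2 → z≤n ; p3 → z≤n ; p4 → z≤n ; p5 → z≤n })
    (λ { p0 → refl ; p1 → refl ; p2 → refl ; p3 → refl }) deg≥
peel₆ k a b (suc c) (suc d) e f deg≥ =
  peel-matching (selection false false true true false false)
    (λ { p0 → z≤n ; p1 → z≤n ; p2 → s≤s z≤n ; p3 → s≤s z≤n ; p4 → z≤n ; p5 → z≤n })
    (λ { p0 → refl ; p1 → refl ; p2 → refl ; p3 → refl }) deg≥
peel₆ k a b c d (suc e) (suc f) deg≥ =
  peel-matching (selection false false false false true true)
    (λ { p0 → z≤n ; p1 → z≤n ; p2 → z≤n ; p3 → z≤n ; p4 → s≤s z≤n ; p5 → s≤s z≤n })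
    (λ { p0 → refl ; p1 → refl ; p2 → refl ; p3 → refl }) deg≥
-- No perfect matching is available, so each matching misses a type.  Either the three
-- missing types all meet a vertex, which then has degree 0, or they form the triangle
-- opposite a vertex; then its star is taken, each leaf having all its edges in the star.
peel₆ k a zero c zero e zero deg≥ = peeling (selection true false true false true false)
  (λ { p0 → m<n⇒0<n a>k ; p1 → z≤n ; p2 → m<n⇒0<n c>k ; p3 → z≤n
     ; p4 → m<n⇒0<n (deg≥ p3) ; p5 → z≤n })
  (λ { p0 → refl ; p1 → refl ; p2 → refl ; p3 → refl })
  (λ { p0 → star-centre k a c e a>k c>k (deg≥ p3) ; p1 → <⇒+1≤ (deg≥ p1) ; p2 → <⇒+1≤ (deg≥ p2) ; p3 → <⇒+1≤ (deg≥ p3) })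
  where
  a>k : suc k ≤ a
  a>k = subst (suc k ≤_) (trans (+-identityʳ _) (+-identityʳ a)) (deg≥ p1)
  c>k : suc k ≤ c
  c>k = subst (suc k ≤_) (+-identityʳ c) (deg≥ p2)
peel₆ k a zero zero d zero f deg≥ = peeling (selection true false false true false true)
  (λ { p0 → m<n⇒0<n a>k ; p1 → z≤n ; p2 → z≤n ; p3 → m<n⇒0<n d>k
     ; p4 → z≤n ; p5 → m<n⇒0<n (deg≥ p2) })
  (λ { p0 → refl ; p1 → refl ; p2 → refl ; p3 → refl })
  (λ { p0 → <⇒+1≤ (deg≥ p0) ; p1 → star-centre k a d f a>k d>k (deg≥ p2) ; p2 → <⇒+1≤ (deg≥ p2) ; p3 → <⇒+1≤ (deg≥ p3) })
  where
  a>k : suc k ≤ a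
  a>k = subst (suc k ≤_) (trans (+-identityʳ _) (+-identityʳ a)) (deg≥ p0)
  d>k : suc k ≤ d
  d>k = subst (suc k ≤_) (+-identityʳ d) (deg≥ p3)
peel₆ k zero b c zero zero f deg≥ = peeling (selection false true true false false true)
  (λ { p0 → z≤n ; p1 → m<n⇒0<n b>k ; p2 → m<n⇒0<n c>k ; p3 → z≤n
     ; p4 → z≤n ; p5 → m<n⇒0<n (deg≥ p1) })
  (λ { p0 → refl ; p1 → refl ; p2 → refl ; p3 → refl })
  (λ { p0 → <⇒+1≤ (deg≥ p0) ; p1 → <⇒+1≤ (deg≥ p1) ; p2 → star-centre k b c f b>k c>k (deg≥ p1) ; p3 → <⇒+1≤ (deg≥ p3) })
  where
  b>k : suc k ≤ b
  b>k = subst (suc k ≤_) (trans (+-identityʳ _) (+-identityʳ b)) (deg≥ p3)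
  c>k : suc k ≤ c
  c>k = subst (suc k ≤_) (+-identityʳ c) (deg≥ p0)
peel₆ k zero b zero d e zero deg≥ = peeling (selection false true false true true false)
  (λ { p0 → z≤n ; p1 → m<n⇒0<n b>k ; p2 → z≤n ; p3 → m<n⇒0<n d>k
     ; p4 → m<n⇒0<n (deg≥ p0) ; p5 → z≤n })
  (λ { p0 → refl ; p1 → refl ; p2 → refl ; p3 → refl })
  (λ { p0 → <⇒+1≤ (deg≥ p0) ; p1 → <⇒+1≤ (deg≥ p1) ; p2 → <⇒+1≤ (deg≥ p2) ; p3 → star-centre k b d e b>k d>k (deg≥ p0) })
  where
  b>k : suc k ≤ b
  b>k = subst (suc k ≤_) (trans (+-identityʳ _) (+-identityʳ b)) (deg≥ p2)
  d>k : suc k ≤ d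
  d>k = subst (suc k ≤_) (+-identityʳ d) (deg≥ p1)
peel₆ k a zero c zero zero f deg≥ with () ← deg≥ p3
peel₆ k a zero zero d e zero deg≥ with () ← deg≥ p2
peel₆ k zero b c zero e zero deg≥ with () ← deg≥ p1
peel₆ k zero b zero d zero f deg≥ with () ← deg≥ p0

peel : ∀ {k} (N : Pair → ℕ) → (∀ j → suc k ≤ pairDegree N j) → Peeling k N
peel {k} N deg≥ = transport (peel₆ k (N p0) (N p1) (N p2) (N p3) (N p4) (N p5)
  (λ { p0 → deg≥ p0 ; p1 → deg≥ p1 ; p2 → deg≥ p2 ; p3 → deg≥ p3 }))
  where
  N₆ : Pair → ℕ
  N₆ = multiplicities (N p0) (N p1) (N p2) (N p3) (N p4) (N p5)
  N₆≡N : ∀ τ → N₆ τ ≡ N τ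
  N₆≡N p0 = refl
  N₆≡N p1 = refl
  N₆≡N p2 = refl
  N₆≡N p3 = refl
  N₆≡N p4 = refl
  N₆≡N p5 = refl
  transport : Peeling k N₆ → Peeling k N
  transport (peeling P P≤N odd-P rest) = peeling P
    (λ τ → subst (indicator (P τ) ≤_) (N₆≡N τ) (P≤N τ)) odd-P
    (λ j → subst (k + pairDegree (indicator ∘ P) j ≤_) (pairDegree-cong N₆≡N j) (rest j))

labelCount : (Pair → ℕ) → (Pair → ℕ → ℕ) → ℕ → Pair → ℕ
labelCount N lab l τ = Σ< (N τ) (λ r → indicator (lab τ r ≡ᵇ l))

-- lab τ r is the label of the r-th of the N τ parallel copies of type τ.
DisjointJoins : ℕ → (Pair → ℕ) → Set
DisjointJoins k N = Σ (Pair → ℕ → ℕ) λ lab → ∀ l j → l < k → odd (pairDegree (labelCount N lab l) j) ≡ true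

Σ<-prepend-label : ∀ b n (lab : ℕ → ℕ) l →
  Σ< (n + indicator b) (λ r → indicator ((if b ∧ (r ≡ᵇ n) then 0 else suc (lab r)) ≡ᵇ l))
  ≡ indicator (b ∧ (0 ≡ᵇ l)) + Σ< n (λ r → indicator (suc (lab r) ≡ᵇ l))
Σ<-prepend-label false n lab l rewrite +-identityʳ n = refl
Σ<-prepend-label true  n lab l rewrite +-comm n 1 | ≡ᵇ-refl n = begin
  Σ< n (λ r → indicator ((if r ≡ᵇ n then 0 else suc (lab r)) ≡ᵇ l)) + indicator (0 ≡ᵇ l)
    ≡⟨ cong (_+ indicator (0 ≡ᵇ l)) (Σ<-cong n (λ r r<n →
         cong (λ t → indicator ((if t then 0 else suc (lab r)) ≡ᵇ l)) (≡ᵇ-false r n (<⇒≢ r<n)))) ⟩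
  Σ< n (λ r → indicator (suc (lab r) ≡ᵇ l)) + indicator (0 ≡ᵇ l)
    ≡⟨ +-comm _ (indicator (0 ≡ᵇ l)) ⟩
  indicator (0 ≡ᵇ l) + Σ< n (λ r → indicator (suc (lab r) ≡ᵇ l)) ∎
  where open ≡-Reasoning

disjointJoins : ∀ k (N : Pair → ℕ) → (∀ j → k ≤ pairDegree N j) → DisjointJoins k N
disjointJoins zero    N _     = (λ _ _ → 0) , λ _ _ ()
disjointJoins (suc k) N deg≥ = lab , odd-degree
  where
  open Peeling (peel N deg≥)
  N′ : Pair → ℕ
  N′ τ = N τ ∸ indicator (chosen τ)
  N≡ : ∀ τ → N τ ≡ N′ τ + indicator (chosen τ)
  N≡ τ = sym (m∸n+n≡m (chosen≤ τ))
  deg′≥ : ∀ j → k ≤ pairDegree N′ j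
  deg′≥ j = +-cancelʳ-≤ (pairDegree (indicator ∘ chosen) j) k (pairDegree N′ j)
    (subst (k + pairDegree (indicator ∘ chosen) j ≤_)
      (trans (pairDegree-cong N≡ j) (pairDegree-+ N′ (indicator ∘ chosen) j)) (remaining j))
  rec : DisjointJoins k N′
  rec = disjointJoins k N′ deg′≥
  lab′ : Pair → ℕ → ℕ
  lab′ = proj₁ rec
  lab : Pair → ℕ → ℕ
  lab τ r = if chosen τ ∧ (r ≡ᵇ N′ τ) then 0 else suc (lab′ τ r)
  labelCount≡ : ∀ l τ → labelCount N lab l τ
    ≡ indicator (chosen τ ∧ (0 ≡ᵇ l)) + Σ< (N′ τ) (λ r → indicator (suc (lab′ τ r) ≡ᵇ l))
  labelCount≡ l τ =
    trans (cong (λ n → Σ< n (λ r → indicator (lab τ r ≡ᵇ l))) (N≡ τ))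
          (Σ<-prepend-label (chosen τ) (N′ τ) (lab′ τ) l)
  odd-degree : ∀ l j → l < suc k → odd (pairDegree (labelCount N lab l) j) ≡ true
  odd-degree zero j _ = trans (cong odd (pairDegree-cong (λ τ → begin
      labelCount N lab 0 τ                                      ≡⟨ labelCount≡ 0 τ ⟩
      indicator (chosen τ ∧ true) + Σ< (N′ τ) (λ _ → 0)         ≡⟨ cong₂ _+_ (cong indicator (∧-identityʳ _)) (Σ<-zero (N′ τ)) ⟩
      indicator (chosen τ) + 0                                  ≡⟨ +-identityʳ _ ⟩
      indicator (chosen τ)                                      ∎) j)) (chosen-odd j)
    where open ≡-Reasoning
  odd-degree (suc l) j (s≤s l<k) = trans (cong odd (pairDegree-cong (λ τ →
      trans (labelCount≡ (suc l) τ) (cong (_+ labelCount N′ lab′ l τ) (cong indicator (∧-zeroʳ (chosen τ))))) j))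
    (proj₂ rec l j l<k)

inFour-vs : ∀ {n} (vs : Fin 4 → Fin n) j → inFour vs (vs j) ≡ true
inFour-vs vs p0 rewrite ==-refl (vs p0) = refl
inFour-vs vs p1 rewrite ==-refl (vs p1) = ∨-zeroʳ _
inFour-vs vs p2 rewrite ==-refl (vs p2) = trans (cong ((vs p0 == vs p2) ∨_) (∨-zeroʳ _)) (∨-zeroʳ _)
inFour-vs vs p3 rewrite ==-refl (vs p3) =
  trans (cong ((vs p0 == vs p3) ∨_) (trans (cong ((vs p1 == vs p3) ∨_) (∨-zeroʳ _)) (∨-zeroʳ _))) (∨-zeroʳ _)

even⇒⌊/2⌋+⌊/2⌋ : ∀ {d} → 2 ∣ d → d ≡ ⌊ d /2⌋ + ⌊ d /2⌋
even⇒⌊/2⌋+⌊/2⌋ (divides q refl) rewrite *-comm q 2 | +-identityʳ q = cong (λ h → h + h) (n≡⌊n+n/2⌋ q)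

module SplitOff {n m : ℕ} (G : Graph n m) (vs : Fin 4 → Fin n) (vs-injective : Injective _≡_ _≡_ vs)
  (touches : ∀ e → (inFour vs (end₁ G e) ≡ true) ⊎ (inFour vs (end₂ G e) ≡ true)) where

  terminal : Fin n → Bool
  terminal = inFour vs

  ==-nonterminal : ∀ {u y} → terminal u ≡ true → terminal y ≡ false → (u == y) ≡ false
  ==-nonterminal tu ty = ==-false λ { refl → contradiction (trans (sym tu) ty) λ () }

  index : Fin n → Fin 4
  index v = if vs p0 == v then p0 else if vs p1 == v then p1 else if vs p2 == v then p2 else p3

  vs-index : ∀ v → terminal v ≡ true → vs (index v) ≡ v
  vs-index v tv with vs p0 == v in e₀
  ... | true = ==-true _ _ e₀
  ... | false with vs p1 == v in e₁
  ... | true = ==-true _ _ e₁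
  ... | false with vs p2 == v in e₂
  ... | true = ==-true _ _ e₂
  ... | false with vs p3 == v in e₃
  ... | true = ==-true _ _ e₃
  ... | false = contradiction tv λ ()

  index-== : ∀ {v} → terminal v ≡ true → ∀ j → (v == vs j) ≡ (index v == j)
  index-== {v} tv j = trans (cong (_== vs j) (sym (vs-index v tv))) (==-cong vs-injective (index v) j)

  -- Every edge has an end among the vs, its far end; the other end is its owner.
  owner far : Fin m → Fin n
  owner e = if terminal (end₂ G e) then end₁ G e else end₂ G e
  far   e = if terminal (end₂ G e) then end₂ G e else end₁ G e

  far-terminal : ∀ e → terminal (far e) ≡ true
  far-terminal e with terminal (end₂ G e) in t₂ | touches e
  ... | true  | _      = t₂
  ... | false | inj₁ t₁ = t₁

  incident-owner-far : ∀ e v → incident G e v ≡ ((owner e == v) ∨ (far e == v))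
  incident-owner-far e v with terminal (end₂ G e)
  ... | true  = refl
  ... | false = ∨-comm (end₁ G e == v) (end₂ G e == v)

  owner≢far : ∀ e → owner e ≢ far e
  owner≢far e with terminal (end₂ G e)
  ... | true  = loopless G e
  ... | false = loopless G e ∘ sym

  joins-owner-far : ∀ e {y} v → terminal y ≡ false → joins G e y v ≡ ((owner e == y) ∧ (far e == v))
  joins-owner-far e {y} v ty with terminal (end₂ G e) in t₂ | touches e
  ... | true  | _       rewrite ==-nonterminal t₂ ty =
    trans (cong (((end₁ G e == y) ∧ (end₂ G e == v)) ∨_) (∧-zeroʳ _)) (∨-identityʳ _)
  ... | false | inj₁ t₁ rewrite ==-nonterminal t₁ ty = ∧-comm (end₁ G e == v) (end₂ G e == y)

  class : Fin m → Fin 4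
  class e = index (far e)

  far-==-vs : ∀ e j → (far e == vs j) ≡ (class e == j)
  far-==-vs e j = index-== (far-terminal e) j

  incident-vs : ∀ e j → incident G e (vs j) ≡ ((owner e == vs j) ∨ (class e == j))
  incident-vs e j = trans (incident-owner-far e (vs j)) (cong ((owner e == vs j) ∨_) (far-==-vs e j))

  incident-nonterminal : ∀ e {y} → terminal y ≡ false → incident G e y ≡ (owner e == y)
  incident-nonterminal e {y} ty = trans (incident-owner-far e y)
    (trans (cong ((owner e == y) ∨_) (==-nonterminal (far-terminal e) ty)) (∨-identityʳ _))

  ∧-incident-vs-by-owner : ∀ (Z : Fin n → Fin m → Bool) j x e →
    ((Z (owner e) e ∧ incident G e (vs j)) ∧ (owner e == x))
    ≡ ((owner e == x) ∧ (((x == vs j) ∨ (class e == j)) ∧ Z x e))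
  ∧-incident-vs-by-owner Z j x e = begin
    (Z (owner e) e ∧ incident G e (vs j)) ∧ (owner e == x)
      ≡⟨ ∧-comm _ (owner e == x) ⟩
    (owner e == x) ∧ (Z (owner e) e ∧ incident G e (vs j))
      ≡⟨ cong (λ b → (owner e == x) ∧ (Z (owner e) e ∧ b)) (incident-vs e j) ⟩
    (owner e == x) ∧ (Z (owner e) e ∧ ((owner e == vs j) ∨ (class e == j)))
      ≡⟨ ==-∧-subst (λ o → Z o e ∧ ((o == vs j) ∨ (class e == j))) (owner e) x ⟩
    (owner e == x) ∧ (Z x e ∧ ((x == vs j) ∨ (class e == j)))
      ≡⟨ cong ((owner e == x) ∧_) (∧-comm (Z x e) _) ⟩
    (owner e == x) ∧ (((x == vs j) ∨ (class e == j)) ∧ Z x e) ∎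
    where open ≡-Reasoning

  ∧-incident-nonterminal-by-owner : ∀ (Z : Fin n → Fin m → Bool) {y} → terminal y ≡ false → ∀ e →
    (Z (owner e) e ∧ incident G e y) ≡ ((owner e == y) ∧ Z y e)
  ∧-incident-nonterminal-by-owner Z {y} ty e = trans (cong (Z (owner e) e ∧_) (incident-nonterminal e ty))
    (trans (∧-comm _ (owner e == y)) (==-∧-subst (λ o → Z o e) (owner e) y))

  ownedCount : Fin n → ℕ
  ownedCount x = count (λ e → owner e == x)

  classCount : Fin n → Fin 4 → ℕ
  classCount x c = count (λ e → (owner e == x) ∧ (class e == c))

  ownedCount≡sum : ∀ x → ownedCount x ≡ sum (classCount x)
  ownedCount≡sum x = count-partition _ class

  -- The edges owned by x, listed class by class; position e is the place of e in that list.
  position : Fin m → ℕ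
  position e = blockStart (classCount (owner e)) (class e)
             + rank (λ e′ → (owner e′ == owner e) ∧ (class e′ == class e)) e

  classAt : Fin n → ℕ → Fin 4
  classAt x = blockAt (classCount x)

  count-owned : ∀ x (R : Fin 4 → ℕ → Bool) →
    count (λ e → (owner e == x) ∧ R (class e) (position e))
    ≡ Σ< (ownedCount x) (λ r → indicator (R (classAt x r) r))
  count-owned x R = begin
    count (λ e → (owner e == x) ∧ R (class e) (position e))
      ≡⟨ count-partition _ class ⟩
    sum (λ c → count (λ e → ((owner e == x) ∧ R (class e) (position e)) ∧ (class e == c)))
      ≡⟨ sum-cong-≗ (λ c → count-cong (λ e → ==-∧-subst₂ (λ o c′ → R c′ (positionAs o c′ e)) (owner e) x (class e) c)) ⟩
    sum (λ c → count (λ e → ((owner e == x) ∧ (class e == c)) ∧ R c (positionAs x c e)))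
      ≡⟨ sum-cong-≗ (λ c → count-∧-rank (λ e → (owner e == x) ∧ (class e == c)) (λ r → R c (start c + r))) ⟩
    sum (λ c → Σ< (classCount x c) (λ r → indicator (R c (start c + r))))
      ≡⟨ sum-cong-≗ (λ c → Σ<-cong (classCount x c) (λ r r<n →
           cong (λ c′ → indicator (R c′ (start c + r))) (sym (blockAt-start (classCount x) c r r<n)))) ⟩
    sum (λ c → Σ< (classCount x c) (λ r → indicator (R (classAt x (start c + r)) (start c + r))))
      ≡⟨ sum-Σ<-blocks (classCount x) (λ r → indicator (R (classAt x r) r)) ⟩
    Σ< (sum (classCount x)) (λ r → indicator (R (classAt x r) r))
      ≡⟨ cong (λ d → Σ< d (λ r → indicator (R (classAt x r) r))) (ownedCount≡sum x) ⟨
    Σ< (ownedCount x) (λ r → indicator (R (classAt x r) r)) ∎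
    where
    open ≡-Reasoning
    start : Fin 4 → ℕ
    start = blockStart (classCount x)
    positionAs : Fin n → Fin 4 → Fin m → ℕ
    positionAs o c e = blockStart (classCount o) c + rank (λ e′ → (owner e′ == o) ∧ (class e′ == c)) e

  classCount-index : ∀ {x} → terminal x ≡ true → classCount x (index x) ≡ 0
  classCount-index {x} tx = count-false _ not-both
    where
    not-both : ∀ e → ((owner e == x) ∧ (class e == index x)) ≡ false
    not-both e with owner e ≟ x | class e ≟ index x
    ... | yes refl | yes c≡ = contradiction
      (trans (sym (vs-index _ tx)) (trans (cong vs (sym c≡)) (vs-index (far e) (far-terminal e)))) (owner≢far e)
    ... | yes refl | no _   = refl
    ... | no _     | _      = refl

  classAt-≢-index : ∀ {x} → terminal x ≡ true → ∀ r → r < ownedCount x → classAt x r ≢ index x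
  classAt-≢-index {x} tx r r<d =
    blockAt-≢-empty (classCount x) (classCount-index tx) (subst (r <_) (ownedCount≡sum x) r<d)

  degree-nonterminal : ∀ {y} → terminal y ≡ false → degree G y ≡ ownedCount y
  degree-nonterminal ty = count-cong (λ e → incident-nonterminal e ty)

  multiplicity-nonterminal : ∀ {y} → terminal y ≡ false → ∀ c → multiplicity G y (vs c) ≡ classCount y c
  multiplicity-nonterminal {y} ty c =
    count-cong (λ e → trans (joins-owner-far e (vs c) ty) (cong ((owner e == y) ∧_) (far-==-vs e c)))

  edgesAvoiding-nonterminal : ∀ {y} → terminal y ≡ false → ∀ c →
    edgesAvoiding G y (vs c) ≡ count (λ e → (owner e == y) ∧ not (class e == c))
  edgesAvoiding-nonterminal {y} ty c = count-cong λ e → begin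
    incident G e y ∧ not (incident G e (vs c))
      ≡⟨ cong₂ (λ a b → a ∧ not b) (incident-nonterminal e ty) (incident-vs e c) ⟩
    (owner e == y) ∧ not ((owner e == vs c) ∨ (class e == c))
      ≡⟨ ==-∧-subst (λ o → not ((o == vs c) ∨ (class e == c))) (owner e) y ⟩
    (owner e == y) ∧ not ((y == vs c) ∨ (class e == c))
      ≡⟨ cong (λ b → (owner e == y) ∧ not (b ∨ (class e == c))) y≠vs ⟩
    (owner e == y) ∧ not (class e == c) ∎
    where
    open ≡-Reasoning
    y≠vs : (y == vs c) ≡ false
    y≠vs = trans (==-sym y (vs c)) (==-nonterminal (inFour-vs vs c) ty)

  half : Fin n → ℕ
  half x = ⌊ ownedCount x /2⌋

  -- An edge owned by a terminal x stays a virtual edge from x to its far end.  The edges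
  -- owned by a non-terminal y are split off in pairs: those at positions t and half y + t
  -- (which have different classes) become one virtual edge joining their far ends.
  virtualCount : Fin n → ℕ
  virtualCount x = if terminal x then ownedCount x else half x

  virtualOf : Fin n → ℕ → ℕ
  virtualOf x r = if terminal x then r else if r <ᵇ half x then r else r ∸ half x

  virtualType : Fin n → ℕ → Pair
  virtualType x t =
    if terminal x then pair (index x) (classAt x t) else pair (classAt x t) (classAt x (half x + t))

  virtualCount-terminal : ∀ {x} → terminal x ≡ true → virtualCount x ≡ ownedCount x
  virtualCount-terminal {x} tx = cong (λ b → if b then ownedCount x else half x) tx

  virtualCount-nonterminal : ∀ {x} → terminal x ≡ false → virtualCount x ≡ half x
  virtualCount-nonterminal {x} tx = cong (λ b → if b then ownedCount x else half x) tx

  virtualOf-terminal : ∀ {x} → terminal x ≡ true → ∀ r → virtualOf x r ≡ r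
  virtualOf-terminal {x} tx r = cong (λ b → if b then r else if r <ᵇ half x then r else r ∸ half x) tx

  virtualOf-low : ∀ {x} → terminal x ≡ false → ∀ {t} → t < half x → virtualOf x t ≡ t
  virtualOf-low {x} tx {t} t<h =
    trans (cong (λ b → if b then t else if t <ᵇ half x then t else t ∸ half x) tx)
          (cong (λ b → if b then t else t ∸ half x) (<ᵇ-true t<h))

  virtualOf-high : ∀ {x} → terminal x ≡ false → ∀ t → virtualOf x (half x + t) ≡ t
  virtualOf-high {x} tx t =
    trans (cong (λ b → if b then r else if r <ᵇ half x then r else r ∸ half x) tx)
          (trans (cong (λ b → if b then r else r ∸ half x) (<ᵇ-false r (half x) (m≤m+n _ t))) (m+n∸m≡n (half x) t))
    where
    r : ℕ
    r = half x + t

  virtualType-terminal : ∀ {x} → terminal x ≡ true → ∀ t → virtualType x t ≡ pair (index x) (classAt x t)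
  virtualType-terminal {x} tx t =
    cong (λ b → if b then pair (index x) (classAt x t) else pair (classAt x t) (classAt x (half x + t))) tx

  virtualType-nonterminal : ∀ {x} → terminal x ≡ false → ∀ t →
    virtualType x t ≡ pair (classAt x t) (classAt x (half x + t))
  virtualType-nonterminal {x} tx t =
    cong (λ b → if b then pair (index x) (classAt x t) else pair (classAt x t) (classAt x (half x + t))) tx

  typeCount : Pair → Fin n → ℕ
  typeCount τ x = Σ< (virtualCount x) (λ t → indicator (virtualType x t == τ))

  virtualMultiplicity : Pair → ℕ
  virtualMultiplicity τ = sum (typeCount τ)

  -- The copies of each type are numbered consecutively, owner after owner.
  copyIndex : Fin n → ℕ → ℕ
  copyIndex x t = blockStart (typeCount (virtualType x t)) x
                + Σ< t (λ t′ → indicator (virtualType x t′ == virtualType x t))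

  sum-labelled-copies : ∀ (lab : Pair → ℕ → ℕ) l τ →
    sum (λ x → Σ< (virtualCount x) (λ t → indicator ((virtualType x t == τ) ∧ (lab (virtualType x t) (copyIndex x t) ≡ᵇ l))))
    ≡ labelCount virtualMultiplicity lab l τ
  sum-labelled-copies lab l τ = begin
    sum (λ x → Σ< (virtualCount x) (λ t → indicator ((virtualType x t == τ) ∧ (lab (virtualType x t) (copyIndex x t) ≡ᵇ l))))
      ≡⟨ sum-cong-≗ (λ x → Σ<-cong (virtualCount x) (λ t _ → cong indicator
           (==-∧-subst (λ u → lab u (blockStart (typeCount u) x + Σ< t (λ t′ → indicator (virtualType x t′ == u))) ≡ᵇ l)
                       (virtualType x t) τ))) ⟩
    sum (λ x → Σ< (virtualCount x) (λ t → indicator ((virtualType x t == τ) ∧ Q x (Σ< t (λ t′ → indicator (virtualType x t′ == τ))))))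
      ≡⟨ sum-cong-≗ (λ x → Σ<-∧-rank (virtualCount x) (λ t → virtualType x t == τ) (Q x)) ⟩
    sum (λ x → Σ< (typeCount τ x) (λ r → indicator (Q x r)))
      ≡⟨ sum-Σ<-blocks (typeCount τ) (λ r → indicator (lab τ r ≡ᵇ l)) ⟩
    labelCount virtualMultiplicity lab l τ ∎
    where
    open ≡-Reasoning
    Q : Fin n → ℕ → Bool
    Q x r = lab τ (blockStart (typeCount τ) x + r) ≡ᵇ l

  module Balanced
    (even : ∀ y → terminal y ≡ false → 2 ∣ degree G y)
    (balanced : ∀ y → terminal y ≡ false → ∀ c → multiplicity G y (vs c) ≤ edgesAvoiding G y (vs c)) where

    ownedCount-halves : ∀ {y} → terminal y ≡ false → ownedCount y ≡ half y + half y
    ownedCount-halves {y} ty = even⇒⌊/2⌋+⌊/2⌋ (subst (2 ∣_) (degree-nonterminal ty) (even y ty))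

    classCount≤half : ∀ {y} → terminal y ≡ false → ∀ c → classCount y c ≤ half y
    classCount≤half {y} ty c = begin
      classCount y c                        ≡⟨ n≡⌊n+n/2⌋ (classCount y c) ⟩
      ⌊ classCount y c + classCount y c /2⌋ ≤⟨ ⌊n/2⌋-mono twice≤ ⟩
      half y                                ∎
      where
      open ≤-Reasoning
      twice≤ : classCount y c + classCount y c ≤ ownedCount y
      twice≤ = begin
        classCount y c + classCount y c
          ≤⟨ +-monoʳ-≤ (classCount y c)
               (subst₂ _≤_ (multiplicity-nonterminal ty c) (edgesAvoiding-nonterminal ty c) (balanced y ty c)) ⟩
        classCount y c + count (λ e → (owner e == y) ∧ not (class e == c))
          ≡⟨ count-∧-not (λ e → owner e == y) (λ e → class e == c) ⟨
        ownedCount y ∎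

    classAt-≢-shift : ∀ {y} → terminal y ≡ false → ∀ t → t < half y → classAt y t ≢ classAt y (half y + t)
    classAt-≢-shift {y} ty t t<h = blockAt-≢-shift (classCount y) (classCount≤half ty) t
      (subst (half y + t <_) (trans (sym (ownedCount-halves ty)) (ownedCount≡sum y)) (+-monoʳ-< (half y) t<h))

    owned-at-terminal : ∀ {x} → terminal x ≡ true → ∀ j (Z : ℕ → Bool) →
      Σ< (ownedCount x) (λ r → indicator (((x == vs j) ∨ (classAt x r == j)) ∧ Z (virtualOf x r)))
      ≡ Σ< (virtualCount x) (λ t → pairDegree (λ τ → indicator ((virtualType x t == τ) ∧ Z t)) j)
    owned-at-terminal {x} tx j Z = begin
      Σ< (ownedCount x) (λ r → indicator (((x == vs j) ∨ (classAt x r == j)) ∧ Z (virtualOf x r)))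
        ≡⟨ Σ<-cong (ownedCount x) pair-with-x ⟩
      Σ< (ownedCount x) (λ t → pairDegree (λ τ → indicator ((virtualType x t == τ) ∧ Z t)) j)
        ≡⟨ cong (λ d → Σ< d (λ t → pairDegree (λ τ → indicator ((virtualType x t == τ) ∧ Z t)) j))
                (virtualCount-terminal tx) ⟨
      Σ< (virtualCount x) (λ t → pairDegree (λ τ → indicator ((virtualType x t == τ) ∧ Z t)) j) ∎
      where
      open ≡-Reasoning
      pair-with-x : ∀ r → r < ownedCount x →
        indicator (((x == vs j) ∨ (classAt x r == j)) ∧ Z (virtualOf x r))
        ≡ pairDegree (λ τ → indicator ((virtualType x r == τ) ∧ Z r)) j
      pair-with-x r r<d = begin
        indicator (((x == vs j) ∨ (classAt x r == j)) ∧ Z (virtualOf x r))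
          ≡⟨ cong₂ (λ b s → indicator ((b ∨ (classAt x r == j)) ∧ Z s)) (index-== tx j) (virtualOf-terminal tx r) ⟩
        indicator (((index x == j) ∨ (classAt x r == j)) ∧ Z r)
          ≡⟨ pairDegree-pair-∧ (index x) (classAt x r) j (Z r) (classAt-≢-index tx r r<d ∘ sym) ⟨
        pairDegree (λ τ → indicator ((pair (index x) (classAt x r) == τ) ∧ Z r)) j
          ≡⟨ pairDegree-cong (λ τ → cong (λ p → indicator ((p == τ) ∧ Z r)) (virtualType-terminal tx r)) j ⟨
        pairDegree (λ τ → indicator ((virtualType x r == τ) ∧ Z r)) j ∎

    owned-at-nonterminal : ∀ {x} → terminal x ≡ false → ∀ j (Z : ℕ → Bool) →
      Σ< (ownedCount x) (λ r → indicator (((x == vs j) ∨ (classAt x r == j)) ∧ Z (virtualOf x r)))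
      ≡ Σ< (virtualCount x) (λ t → pairDegree (λ τ → indicator ((virtualType x t == τ) ∧ Z t)) j)
    owned-at-nonterminal {x} tx j Z = begin
      Σ< (ownedCount x) f                  ≡⟨ cong (λ d → Σ< d f) (ownedCount-halves tx) ⟩
      Σ< (H + H) f                         ≡⟨ Σ<-+ H H f ⟩
      Σ< H f + Σ< H (λ t → f (H + t))      ≡⟨ Σ<-distrib-+ H f (λ t → f (H + t)) ⟨
      Σ< H (λ t → f t + f (H + t))         ≡⟨ Σ<-cong H pair-up ⟩
      Σ< H g                               ≡⟨ cong (λ d → Σ< d g) (virtualCount-nonterminal tx) ⟨
      Σ< (virtualCount x) g                ∎
      where
      open ≡-Reasoning
      H : ℕ
      H = half x
      f g : ℕ → ℕ
      f r = indicator (((x == vs j) ∨ (classAt x r == j)) ∧ Z (virtualOf x r))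
      g t = pairDegree (λ τ → indicator ((virtualType x t == τ) ∧ Z t)) j
      x≠vs : (x == vs j) ≡ false
      x≠vs = trans (==-sym x (vs j)) (==-nonterminal (inFour-vs vs j) tx)
      pair-up : ∀ t → t < H → f t + f (H + t) ≡ g t
      pair-up t t<H = begin
        f t + f (H + t)
          ≡⟨ cong₂ _+_ (cong₂ (λ b s → indicator ((b ∨ (classAt x t == j)) ∧ Z s)) x≠vs (virtualOf-low tx t<H))
                       (cong₂ (λ b s → indicator ((b ∨ (classAt x (H + t) == j)) ∧ Z s)) x≠vs (virtualOf-high tx t)) ⟩
        indicator ((classAt x t == j) ∧ Z t) + indicator ((classAt x (H + t) == j) ∧ Z t)
          ≡⟨ indicator-==-∨ j (Z t) (classAt-≢-shift tx t t<H) ⟩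
        indicator (((classAt x t == j) ∨ (classAt x (H + t) == j)) ∧ Z t)
          ≡⟨ pairDegree-pair-∧ _ _ j (Z t) (classAt-≢-shift tx t t<H) ⟨
        pairDegree (λ τ → indicator ((pair (classAt x t) (classAt x (H + t)) == τ) ∧ Z t)) j
          ≡⟨ pairDegree-cong (λ τ → cong (λ p → indicator ((p == τ) ∧ Z t)) (virtualType-nonterminal tx t)) j ⟨
        g t ∎

    labelled-at-vs : ∀ j (Z : Fin n → ℕ → Bool) →
      count (λ e → Z (owner e) (virtualOf (owner e) (position e)) ∧ incident G e (vs j))
      ≡ pairDegree (λ τ → sum (λ x → Σ< (virtualCount x) (λ t → indicator ((virtualType x t == τ) ∧ Z x t)))) j
    labelled-at-vs j Z = begin
      count (λ e → Z (owner e) (virtualOf (owner e) (position e)) ∧ incident G e (vs j))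
        ≡⟨ count-partition _ owner ⟩
      sum (λ x → count (λ e → (Z (owner e) (virtualOf (owner e) (position e)) ∧ incident G e (vs j)) ∧ (owner e == x)))
        ≡⟨ sum-cong-≗ (λ x → count-cong (∧-incident-vs-by-owner (λ o e → Z o (virtualOf o (position e))) j x)) ⟩
      sum (λ x → count (λ e → (owner e == x) ∧ R x (class e) (position e)))
        ≡⟨ sum-cong-≗ (λ x → count-owned x (R x)) ⟩
      sum (λ x → Σ< (ownedCount x) (λ r → indicator (R x (classAt x r) r)))
        ≡⟨ sum-cong-≗ (λ x → owned-at x) ⟩
      sum (λ x → Σ< (virtualCount x) (λ t → pairDegree (g x t) j))
        ≡⟨ sum-cong-≗ (λ x → Σ<-pairDegree (virtualCount x) (g x) j) ⟩
      sum (λ x → pairDegree (λ τ → Σ< (virtualCount x) (λ t → g x t τ)) j)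
        ≡⟨ sum-pairDegree (λ x τ → Σ< (virtualCount x) (λ t → g x t τ)) j ⟩
      pairDegree (λ τ → sum (λ x → Σ< (virtualCount x) (λ t → g x t τ))) j ∎
      where
      open ≡-Reasoning
      R : Fin n → Fin 4 → ℕ → Bool
      R x c r = ((x == vs j) ∨ (c == j)) ∧ Z x (virtualOf x r)
      g : Fin n → ℕ → Pair → ℕ
      g x t τ = indicator ((virtualType x t == τ) ∧ Z x t)
      owned-at : ∀ x → Σ< (ownedCount x) (λ r → indicator (R x (classAt x r) r))
                     ≡ Σ< (virtualCount x) (λ t → pairDegree (g x t) j)
      owned-at x = bool-cases (terminal x) (λ tx → owned-at-terminal tx j (Z x)) (λ tx → owned-at-nonterminal tx j (Z x))

    labelled-at-nonterminal : ∀ {y} → terminal y ≡ false → (Z : Fin n → ℕ → Bool) →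
      count (λ e → Z (owner e) (virtualOf (owner e) (position e)) ∧ incident G e y)
      ≡ Σ< (half y) (indicator ∘ Z y) + Σ< (half y) (indicator ∘ Z y)
    labelled-at-nonterminal {y} ty Z = begin
      count (λ e → Z (owner e) (virtualOf (owner e) (position e)) ∧ incident G e y)
        ≡⟨ count-cong (∧-incident-nonterminal-by-owner (λ o e → Z o (virtualOf o (position e))) ty) ⟩
      count (λ e → (owner e == y) ∧ Z y (virtualOf y (position e)))
        ≡⟨ count-owned y (λ _ r → Z y (virtualOf y r)) ⟩
      Σ< (ownedCount y) f
        ≡⟨ cong (λ d → Σ< d f) (ownedCount-halves ty) ⟩
      Σ< (H + H) f
        ≡⟨ Σ<-+ H H f ⟩
      Σ< H f + Σ< H (λ t → f (H + t))
        ≡⟨ cong₂ _+_ (Σ<-cong H (λ t t<H → cong (indicator ∘ Z y) (virtualOf-low ty t<H)))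
                     (Σ<-cong H (λ t _ → cong (indicator ∘ Z y) (virtualOf-high ty t))) ⟩
      Σ< H (indicator ∘ Z y) + Σ< H (indicator ∘ Z y) ∎
      where
      open ≡-Reasoning
      H : ℕ
      H = half y
      f : ℕ → ℕ
      f r = indicator (Z y (virtualOf y r))
    degree-vs : ∀ j → degree G (vs j) ≡ pairDegree virtualMultiplicity j
    degree-vs j = trans (labelled-at-vs j (λ _ _ → true))
      (pairDegree-cong (λ τ → sum-cong-≗ (λ x → Σ<-cong (virtualCount x) (λ t _ → cong indicator (∧-identityʳ _)))) j)

    module Chains (k : ℕ) (deg≥ : ∀ i → k ≤ degree G (vs i)) where

      joinLabels : DisjointJoins k virtualMultiplicity
      joinLabels = disjointJoins k virtualMultiplicity (λ j → subst (k ≤_) (degree-vs j) (deg≥ j))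

      virtualLabel : Fin n → ℕ → ℕ
      virtualLabel x t = proj₁ joinLabels (virtualType x t) (copyIndex x t)

      label : Fin m → ℕ
      label e = virtualLabel (owner e) (virtualOf (owner e) (position e))

      chain : Fin k → Chain m
      chain i e = label e ≡ᵇ toℕ i

      chain-disjoint : ∀ i j → i ≢ j → ∀ e → chain i e ≡ true → chain j e ≡ false
      chain-disjoint i j i≢j e label≡i =
        trans (cong (_≡ᵇ toℕ j) (≡ᵇ-true (label e) (toℕ i) label≡i)) (≡ᵇ-false (toℕ i) (toℕ j) (i≢j ∘ Fin.toℕ-injective))

      boundary-vs : ∀ i j → boundary G (chain i) (vs j) ≡ true
      boundary-vs i j = begin
        boundary G (chain i) (vs j)
          ≡⟨ parity≡odd-count (λ e → chain i e ∧ incident G e (vs j)) ⟩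
        odd (count (λ e → chain i e ∧ incident G e (vs j)))
          ≡⟨ cong odd (labelled-at-vs j (λ x t → virtualLabel x t ≡ᵇ toℕ i)) ⟩
        odd (pairDegree (λ τ → sum (λ x → Σ< (virtualCount x) (λ t → indicator
              ((virtualType x t == τ) ∧ (virtualLabel x t ≡ᵇ toℕ i))))) j)
          ≡⟨ cong odd (pairDegree-cong (sum-labelled-copies (proj₁ joinLabels) (toℕ i)) j) ⟩
        odd (pairDegree (labelCount virtualMultiplicity (proj₁ joinLabels) (toℕ i)) j)
          ≡⟨ proj₂ joinLabels (toℕ i) j (Fin.toℕ<n i) ⟩
        true ∎
        where open ≡-Reasoning

      boundary-nonterminal : ∀ i {y} → terminal y ≡ false → boundary G (chain i) y ≡ false
      boundary-nonterminal i {y} ty = begin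
        boundary G (chain i) y                            ≡⟨ parity≡odd-count (λ e → chain i e ∧ incident G e y) ⟩
        odd (count (λ e → chain i e ∧ incident G e y))    ≡⟨ cong odd (labelled-at-nonterminal ty Z) ⟩
        odd (Σ< (half y) (indicator ∘ Z y) + Σ< (half y) (indicator ∘ Z y))
                                                          ≡⟨ odd-double (Σ< (half y) (indicator ∘ Z y)) ⟩
        false                                             ∎
        where
        open ≡-Reasoning
        Z : Fin n → ℕ → Bool
        Z x t = virtualLabel x t ≡ᵇ toℕ i

      boundary-chain : ∀ i v → boundary G (chain i) v ≡ inFour vs v
      boundary-chain i v = bool-cases (terminal v) at-terminal at-nonterminal
        where
        at-terminal : terminal v ≡ true → boundary G (chain i) v ≡ inFour vs v
        at-terminal tv = begin
          boundary G (chain i) v               ≡⟨ cong (boundary G (chain i)) (vs-index v tv) ⟨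
          boundary G (chain i) (vs (index v))  ≡⟨ boundary-vs i (index v) ⟩
          true                                 ≡⟨ tv ⟨
          inFour vs v                          ∎
          where open ≡-Reasoning
        at-nonterminal : terminal v ≡ false → boundary G (chain i) v ≡ inFour vs v
        at-nonterminal tv = trans (boundary-nonterminal i tv) (sym tv)

lemma2p3 : (k : ℕ) → 1 ≤ k → (n m : ℕ) → (G : Graph n m) → (vs : Fin 4 → Fin n)
  → Injective _≡_ _≡_ vs
  → (∀ e → (inFour vs (end₁ G e) ≡ true) ⊎ (inFour vs (end₂ G e) ≡ true))
  → (∀ i → k ≤ degree G (vs i))
  → (∀ y → inFour vs y ≡ false → 2 ∣ degree G y)
  → (∀ y → inFour vs y ≡ false → ∀ i → multiplicity G y (vs i) ≤ edgesAvoiding G y (vs i))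
  → Σ (Fin k → Chain m) (λ p →
      (∀ i j → i ≢ j → ∀ e → p i e ≡ true → p j e ≡ false)
      × (∀ i v → boundary G (p i) v ≡ inFour vs v))
lemma2p3 k _ n m G vs vs-injective touches deg≥ even balanced = chain , chain-disjoint , boundary-chain
  where
  open SplitOff G vs vs-injective touches
  open Balanced even balanced
  open Chains k deg≥
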